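{- Let $G$ be a finite simple graph, let $\varphi=[v_1v_2][v_3v_4]\cdots[v_{n-1}v_n]$ be a sequence of pivot operations applicable to $G$, and let $S=\sup(\varphi)$. Then for all $x,y\in V(G)$ with $x\neq y$, $$\det\big((G\varphi)|_{\{x,y\}}\big)=\det\big(G|_{S\oplus\{x,y\}}\big).$$ Consequently, $\{x,y\}\in E(G\varphi)$ if and only if this value equals $1$.
   Context: Graphs are finite, simple (undirected, no loops, no parallel edges). For $X\subseteq V(G)$, $G|_X$ denotes the induced subgraph. $\det H$ for a graph $H$ is the determinant of its adjacency matrix computed over $GF(2)$; the determinant of the empty matrix is $1$. $\oplus$ denotes symmetric difference of sets. For a vertex $x$, $N(x)$ is its neighbourhood and $N'(x)=N(x)\cup\{x\}$. Pivot: for an edge $\{u,v\}\in E(G)$, let $V_1=N'(u)\setminus N'(v)$, $V_2=N'(v)\setminus N'(u)$, $V_3=N'(u)\cap N'(v)$; the graph $G[uv]$ is obtained from $G$ by toggling (adding if absent, removing if present) every pair $\{x,y\}$ with $x\in V_i$, $y\in V_j$, $i\neq j$, all other adjacencies unchanged. A sequence $[v_1v_2][v_3v_4]\cdots[v_{n-1}v_n]$ of pivots is applicable to $G$ if each $\{v_i,v_{i+1}\}$ is an edge of the graph obtained by applying the preceding pivots; $G\varphi$ denotes the resulting graph. The support $\sup(\varphi)=\{v_1\}\oplus\{v_2\}\oplus\cdots\oplus\{v_n\}$ is the set of vertices occurring an odd number of times in the sequence. -}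

module Defs where

open import Data.Bool using (Bool; true; false; _∧_; _∨_; not; _xor_; if_then_else_)
open import Data.Nat using (ℕ)
open import Data.Fin using (Fin; _≟_)
open import Data.Fin.Base using ()
open import Data.List using (List; []; _∷_; filter; foldr)
open import Data.List.Base using (allFin)
open import Data.Product using (_×_; _,_)
open import Data.Unit using (⊤)
open import Relation.Nullary.Decidable using (⌊_⌋)
open import Relation.Binary.PropositionalEquality using (_≡_)

-- A graph on vertex set Fin n, given by its adjacency function
-- (adjacency matrix over GF(2) = Bool with xor / ∧).
Adj : ℕ → Set
Adj n = Fin n → Fin n → Bool

IsSimple : {n : ℕ} → Adj n → Set
IsSimple {n} A = ((x y : Fin n) → A x y ≡ A y x) × ((x : Fin n) → A x x ≡ false)

VSet : ℕ → Set
VSet n = Fin n → Bool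

_==_ : {n : ℕ} → Fin n → Fin n → Bool
x == y = ⌊ x ≟ y ⌋

_⊕_ : {n : ℕ} → VSet n → VSet n → VSet n
(S ⊕ T) x = S x xor T x

pair : {n : ℕ} → Fin n → Fin n → VSet n
pair x y z = (z == x) ∨ (z == y)

elems : {n : ℕ} → VSet n → List (Fin n)
elems {n} X = filter (λ z → Data.Bool._≟_ (X z) true) (allFin n)

remove : {n : ℕ} → Fin n → List (Fin n) → List (Fin n)
remove c [] = []
remove c (d ∷ ds) = if c == d then ds else d ∷ remove c ds

-- GF(2) determinant of the submatrix of M with rows rs and columns cs,
-- by Laplace expansion along the first row (signs vanish over GF(2)).
-- Called only with equal-length lists; empty matrix has determinant 1.
mutual
  detRC : {n : ℕ} → Adj n → List (Fin n) → List (Fin n) → Bool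
  detRC M [] cs = true
  detRC M (r ∷ rs) cs = expand M r rs cs cs

  expand : {n : ℕ} → Adj n → Fin n → List (Fin n) → List (Fin n) → List (Fin n) → Bool
  expand M r rs cs [] = false
  expand M r rs cs (c ∷ ds) = (M r c ∧ detRC M rs (remove c cs)) xor expand M r rs cs ds

detInduced : {n : ℕ} → Adj n → VSet n → Bool
detInduced A X = detRC A (elems X) (elems X)

N' : {n : ℕ} → Adj n → Fin n → VSet n
N' A u x = (x == u) ∨ A u x

-- class of x w.r.t. pivot on uv: 1 = V1, 2 = V2, 3 = V3, 0 = none
data Cls : Set where c0 c1 c2 c3 : Cls

cls : {n : ℕ} → Adj n → Fin n → Fin n → Fin n → Cls
cls A u v x with N' A u x | N' A v x
... | true  | false = c1
... | false | true  = c2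
... | true  | true  = c3
... | false | false = c0

toggle : Cls → Cls → Bool
toggle c1 c2 = true
toggle c1 c3 = true
toggle c2 c1 = true
toggle c2 c3 = true
toggle c3 c1 = true
toggle c3 c2 = true
toggle _ _ = false

pivot : {n : ℕ} → Adj n → Fin n → Fin n → Adj n
pivot A u v x y = A x y xor toggle (cls A u v x) (cls A u v y)

PivotSeq : ℕ → Set
PivotSeq n = List (Fin n × Fin n)

applySeq : {n : ℕ} → Adj n → PivotSeq n → Adj n
applySeq A [] = A
applySeq A ((u , v) ∷ φ) = applySeq (pivot A u v) φ

Applicable : {n : ℕ} → Adj n → PivotSeq n → Set
Applicable A [] = ⊤
Applicable A ((u , v) ∷ φ) = (A u v ≡ true) × Applicable (pivot A u v) φ

sup : {n : ℕ} → PivotSeq n → VSet n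
sup [] x = false
sup ((u , v) ∷ φ) x = ((x == u) xor (x == v)) xor sup φ x

module Submission where

-- The heart of the proof is the single-pivot identity (det-pivot): for an edge uv of a
-- simple graph G and any vertex set Y,  det(G[uv]|_Y) = det(G|_{Y ⊕ {u,v}}).
-- By induction along the pivot sequence this gives det((Gφ)|_X) = det(G|_{sup φ ⊕ X})
-- (det-pivot-sequence), and theorem2 is the case X = {x, y}, where the 2 × 2 minor of a
-- simple graph is its adjacency (det-edge).
--
-- Then det-pivot is
-- proved by cases on Y ∩ {u, v}: if u, v ∉ Y, G[uv]|_Y is the Schur complement of the block
-- [[0,1],[1,0]] on {u, v} in G|_{Y ∪ {u,v}}; if exactly one of them lies in Y, the two
-- minors are congruent up to renaming u and v; if both lie in Y, apply the first case to
-- G[uv], using that pivoting on uv twice is the identity.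

open import Defs
open import Data.Nat using (ℕ; zero; suc; pred)
open import Data.Fin using (Fin; _≟_)
open import Data.Fin.Permutation.Components using (transpose; transpose-inverse)
open import Data.Bool using (Bool; true; false; _∧_; _∨_; not; _xor_; if_then_else_) renaming (_≟_ to _≟ᴮ_)
open import Data.Bool.Properties
  using (xor-assoc; xor-comm; xor-identityʳ; xor-same; ∧-comm; ∧-assoc; ∧-zeroʳ; ∧-identityʳ; ∧-distribˡ-xor; ∧-distribʳ-xor; ∨-comm)
open import Data.List using (List; []; _∷_; length; map; filter; allFin)
open import Data.List.Membership.Propositional.Properties using (∈-allFin; ∈-filter⁻)
open import Data.List.Relation.Unary.Unique.Propositional.Properties using (allFin⁺; filter⁺)
open import Data.List.Membership.Propositional using (_∈_; _∉_)
open import Data.List.Relation.Unary.Any using (here; there)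
open import Data.List.Relation.Unary.All as All using (_∷_)
open import Data.List.Relation.Unary.Unique.Propositional using (Unique)
open import Data.List.Relation.Unary.AllPairs using (_∷_)
open import Data.List.Relation.Binary.Permutation.Propositional as ↭ using (_↭_)
open import Data.Product using (_×_; _,_; proj₁; proj₂)
open import Data.Empty using (⊥-elim)
open import Relation.Nullary using (¬_; Dec; yes; no)
open import Relation.Nullary.Decidable using (dec-true; dec-false; isYes≗does)
open import Relation.Binary.PropositionalEquality using (_≡_; _≢_; refl; sym; trans; cong; cong₂; subst; module ≡-Reasoning)
open import Function.Bundles using (_⇔_; mk⇔)

xor-interchange : ∀ a b c d → (a xor b) xor (c xor d) ≡ (a xor c) xor (b xor d)
xor-interchange a b c d = trans (xor-assoc a b (c xor d)) (trans (cong (a xor_)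
  (trans (sym (xor-assoc b c d)) (trans (cong (_xor d) (xor-comm b c)) (xor-assoc c b d))))
  (sym (xor-assoc a c (b xor d))))

xor-cancelʳ : ∀ a b → (a xor b) xor b ≡ a
xor-cancelʳ a b = trans (xor-assoc a b b) (trans (cong (a xor_) (xor-same b)) (xor-identityʳ a))

xor-absorb : ∀ a b → a xor (b xor a) ≡ b
xor-absorb a b = trans (cong (a xor_) (xor-comm b a)) (trans (sym (xor-assoc a a b)) (cong (_xor b) (xor-same a)))

∧-swap : ∀ a b x → a ∧ (b ∧ x) ≡ b ∧ (a ∧ x)
∧-swap a b x = trans (sym (∧-assoc a b x)) (trans (cong (_∧ x) (∧-comm a b)) (∧-assoc b a x))

==-refl : ∀ {n} (x : Fin n) → (x == x) ≡ true
==-refl x = trans (isYes≗does (x ≟ x)) (dec-true (x ≟ x) refl)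

==-no : ∀ {n} {x y : Fin n} → x ≢ y → (x == y) ≡ false
==-no {x = x} {y} x≢y = trans (isYes≗does (x ≟ y)) (dec-false (x ≟ y) x≢y)

unique-head : ∀ {n} {x : Fin n} {xs} → Unique (x ∷ xs) → x ∉ xs
unique-head (x∉ ∷ _) x∈ = All.lookup x∉ x∈ refl

unique-tail : ∀ {n} {x : Fin n} {xs} → Unique (x ∷ xs) → Unique xs
unique-tail (_ ∷ u) = u

unique-≢ : ∀ {n} {x y : Fin n} {xs} → Unique (x ∷ xs) → y ∈ xs → x ≢ y
unique-≢ (x∉ ∷ _) y∈ = All.lookup x∉ y∈

Σ⊕ : ∀ {n} → List (Fin n) → (Fin n → Bool) → Bool
Σ⊕ [] f = false
Σ⊕ (x ∷ xs) f = f x xor Σ⊕ xs f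

Σ⊕-cong : ∀ {n} (xs : List (Fin n)) {f g} → (∀ x → x ∈ xs → f x ≡ g x) → Σ⊕ xs f ≡ Σ⊕ xs g
Σ⊕-cong [] e = refl
Σ⊕-cong (x ∷ xs) e = cong₂ _xor_ (e x (here refl)) (Σ⊕-cong xs (λ y y∈ → e y (there y∈)))

Σ⊕-zero : ∀ {n} (xs : List (Fin n)) f → (∀ x → x ∈ xs → f x ≡ false) → Σ⊕ xs f ≡ false
Σ⊕-zero [] f e = refl
Σ⊕-zero (x ∷ xs) f e rewrite e x (here refl) = Σ⊕-zero xs f (λ y y∈ → e y (there y∈))

Σ⊕-single : ∀ {n} (xs : List (Fin n)) f v → Unique xs → v ∈ xs →
  (∀ x → x ∈ xs → x ≢ v → f x ≡ false) → Σ⊕ xs f ≡ f v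
Σ⊕-single (x ∷ xs) f .x u (here refl) e =
  trans (cong (f x xor_) (Σ⊕-zero xs f (λ y y∈ → e y (there y∈) (λ y≡x → unique-head u (subst (_∈ xs) y≡x y∈))))) (xor-identityʳ (f x))
Σ⊕-single (x ∷ xs) f v u (there v∈) e rewrite e x (here refl) (unique-≢ u v∈) =
  Σ⊕-single xs f v (unique-tail u) v∈ (λ y y∈ → e y (there y∈))

Σ⊕-xor : ∀ {n} (xs : List (Fin n)) f g → Σ⊕ xs (λ x → f x xor g x) ≡ Σ⊕ xs f xor Σ⊕ xs g
Σ⊕-xor [] f g = refl
Σ⊕-xor (x ∷ xs) f g =
  trans (cong ((f x xor g x) xor_) (Σ⊕-xor xs f g)) (xor-interchange (f x) (g x) (Σ⊕ xs f) (Σ⊕ xs g))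

Σ⊕-scale : ∀ {n} (xs : List (Fin n)) b f → b ∧ Σ⊕ xs f ≡ Σ⊕ xs (λ x → b ∧ f x)
Σ⊕-scale [] b f = ∧-zeroʳ b
Σ⊕-scale (x ∷ xs) b f = trans (∧-distribˡ-xor b (f x) (Σ⊕ xs f)) (cong ((b ∧ f x) xor_) (Σ⊕-scale xs b f))

Σ⊕-swap : ∀ {n} (xs ys : List (Fin n)) (f : Fin n → Fin n → Bool) →
  Σ⊕ xs (λ x → Σ⊕ ys (f x)) ≡ Σ⊕ ys (λ y → Σ⊕ xs (λ x → f x y))
Σ⊕-swap [] ys f = sym (Σ⊕-zero ys _ (λ _ _ → refl))
Σ⊕-swap (x ∷ xs) ys f = trans (cong (Σ⊕ ys (f x) xor_) (Σ⊕-swap xs ys f))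
  (sym (Σ⊕-xor ys (f x) (λ y → Σ⊕ xs (λ x′ → f x′ y))))

Σ⊕-perm : ∀ {n} {xs ys : List (Fin n)} f → xs ↭ ys → Σ⊕ xs f ≡ Σ⊕ ys f
Σ⊕-perm f ↭.refl = refl
Σ⊕-perm f (↭.prep x p) = cong (f x xor_) (Σ⊕-perm f p)
Σ⊕-perm f (↭.swap x y p) = trans (sym (xor-assoc (f x) (f y) _))
  (trans (cong₂ _xor_ (xor-comm (f x) (f y)) (Σ⊕-perm f p)) (xor-assoc (f y) (f x) _))
Σ⊕-perm f (↭.trans p q) = trans (Σ⊕-perm f p) (Σ⊕-perm f q)

Σ⊕-map : ∀ {n} (σ : Fin n → Fin n) xs f → Σ⊕ (map σ xs) f ≡ Σ⊕ xs (λ x → f (σ x))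
Σ⊕-map σ [] f = refl
Σ⊕-map σ (x ∷ xs) f = cong (f (σ x) xor_) (Σ⊕-map σ xs f)

remove-head : ∀ {n} (c : Fin n) cs → remove c (c ∷ cs) ≡ cs
remove-head c cs rewrite ==-refl c = refl

remove-skip : ∀ {n} {c d : Fin n} ds → c ≢ d → remove c (d ∷ ds) ≡ d ∷ remove c ds
remove-skip ds c≢d rewrite ==-no c≢d = refl

remove-⊆ : ∀ {n} {c x : Fin n} cs → x ∈ remove c cs → x ∈ cs
remove-⊆ {c = c} (d ∷ ds) x∈ with c ≟ d
... | yes _ = there x∈
remove-⊆ (d ∷ ds) (here x≡d) | no _ = here x≡d
remove-⊆ (d ∷ ds) (there x∈) | no _ = there (remove-⊆ ds x∈)

remove-unique : ∀ {n} (c : Fin n) cs → Unique cs → Unique (remove c cs)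
remove-unique c [] u = u
remove-unique c (d ∷ ds) (d∉ ∷ u) with c ≟ d
... | yes _ = u
... | no _ = All.tabulate (λ x∈ → All.lookup d∉ (remove-⊆ ds x∈)) ∷ remove-unique c ds u

remove-length : ∀ {n} {c : Fin n} cs k → c ∈ cs → length cs ≡ suc k → length (remove c cs) ≡ k
remove-length {c = c} (d ∷ ds) k c∈ e with c ≟ d
... | yes _ = cong pred e
remove-length (d ∷ ds) k (here refl) e | no c≢d = ⊥-elim (c≢d refl)
remove-length (d ∷ ds) (suc k) (there c∈) e | no _ = cong suc (remove-length ds k c∈ (cong pred e))
remove-length (d ∷ []) zero (there ()) e | no _
remove-length (d ∷ d′ ∷ ds) zero (there _) () | no _

remove-↭ : ∀ {n} (c : Fin n) {xs ys} → xs ↭ ys → remove c xs ↭ remove c ys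
remove-↭ c ↭.refl = ↭.refl
remove-↭ c (↭.prep x p) with c ≟ x
... | yes _ = p
... | no _ = ↭.prep x (remove-↭ c p)
remove-↭ c (↭.swap x y p) with c ≟ x | c ≟ y
... | yes refl | yes refl = ↭.prep c p
... | yes refl | no _ = ↭.prep y p
... | no _ | yes refl = ↭.prep x p
... | no _ | no _ = ↭.swap x y (remove-↭ c p)
remove-↭ c (↭.trans p q) = ↭.trans (remove-↭ c p) (remove-↭ c q)

remove-map : ∀ {n} (σ : Fin n → Fin n) → (∀ x y → σ x ≡ σ y → x ≡ y) → ∀ c cs →
  remove (σ c) (map σ cs) ≡ map σ (remove c cs)
remove-map σ σ-inj c [] = refl
remove-map σ σ-inj c (d ∷ ds) with c ≟ d
... | yes refl = remove-head (σ c) (map σ ds)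
... | no c≢d = trans (remove-skip (map σ ds) (λ e → c≢d (σ-inj c d e))) (cong (σ d ∷_) (remove-map σ σ-inj c ds))

det-cons : ∀ {n} (M : Adj n) r rs cs →
  detRC M (r ∷ rs) cs ≡ Σ⊕ cs (λ d → M r d ∧ detRC M rs (remove d cs))
det-cons M r rs cs = expand≡Σ⊕ cs
  where
  expand≡Σ⊕ : ∀ ds → expand M r rs cs ds ≡ Σ⊕ ds (λ d → M r d ∧ detRC M rs (remove d cs))
  expand≡Σ⊕ [] = refl
  expand≡Σ⊕ (d ∷ ds) = cong ((M r d ∧ detRC M rs (remove d cs)) xor_) (expand≡Σ⊕ ds)

det-cong : ∀ {n} {M N : Adj n} rs cs → (∀ r c → r ∈ rs → c ∈ cs → M r c ≡ N r c) →
  detRC M rs cs ≡ detRC N rs cs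
det-cong [] cs e = refl
det-cong {M = M} {N} (r ∷ rs) cs e = trans (det-cons M r rs cs) (trans
  (Σ⊕-cong cs (λ d d∈ → cong₂ _∧_ (e r d (here refl) d∈)
     (det-cong rs (remove d cs) (λ r′ c′ r′∈ c′∈ → e r′ c′ (there r′∈) (remove-⊆ cs c′∈)))))
  (sym (det-cons N r rs cs)))

-- Over GF(2) there are no signs, so permuting the columns does not change a minor.
det-permute-cols : ∀ {n} (M : Adj n) rs {cs cs′} → cs ↭ cs′ → detRC M rs cs ≡ detRC M rs cs′
det-permute-cols M [] p = refl
det-permute-cols M (r ∷ rs) {cs} {cs′} p = trans (det-cons M r rs cs) (trans
  (Σ⊕-cong cs (λ d _ → cong (M r d ∧_) (det-permute-cols M rs (remove-↭ d p))))
  (trans (Σ⊕-perm _ p) (sym (det-cons M r rs cs′))))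

-- Expanding along two rows gives a sum over ordered pairs (c, d) of distinct columns;
-- H c d L receives the remaining columns L.
pairSum : ∀ {n} → List (Fin n) → (Fin n → Fin n → List (Fin n) → Bool) → Bool
pairSum cs H = Σ⊕ cs (λ c → Σ⊕ (remove c cs) (λ d → H c d (remove d (remove c cs))))

pairSum-cong : ∀ {n} (cs : List (Fin n)) {H H′} → (∀ c d L → H c d L ≡ H′ c d L) → pairSum cs H ≡ pairSum cs H′
pairSum-cong cs e = Σ⊕-cong cs (λ c _ → Σ⊕-cong (remove c cs) (λ d _ → e c d _))

pairSum-step : ∀ {n} (e : Fin n) es H → Unique (e ∷ es) →
  pairSum (e ∷ es) H ≡ Σ⊕ es (λ d → H e d (remove d es)) xor
                        (Σ⊕ es (λ c → H c e (remove c es)) xor pairSum es (λ c d L → H c d (e ∷ L)))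
pairSum-step e es H u = cong₂ _xor_
  (cong (λ L → Σ⊕ L (λ d → H e d (remove d L))) (remove-head e es))
  (trans (Σ⊕-cong es (λ c c∈ → pairs-at c (λ c≡e → unique-≢ u c∈ (sym c≡e))))
         (Σ⊕-xor es (λ c → H c e (remove c es)) _))
  where
  pairs-at : ∀ c → c ≢ e → Σ⊕ (remove c (e ∷ es)) (λ d → H c d (remove d (remove c (e ∷ es))))
             ≡ H c e (remove c es) xor Σ⊕ (remove c es) (λ d → H c d (e ∷ remove d (remove c es)))
  pairs-at c c≢e = trans (cong (λ L → Σ⊕ L (λ d → H c d (remove d L))) (remove-skip es c≢e))
    (cong₂ _xor_ (cong (H c e) (remove-head e (remove c es)))
       (Σ⊕-cong (remove c es) (λ d d∈ → cong (H c d) (remove-skip (remove c es)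
          (λ d≡e → unique-≢ u (remove-⊆ es d∈) (sym d≡e))))))

pairSum-flip : ∀ {n} (cs : List (Fin n)) H → Unique cs → pairSum cs H ≡ pairSum cs (λ c d L → H d c L)
pairSum-flip [] H u = refl
pairSum-flip (e ∷ es) H u = trans (pairSum-step e es H u) (trans
  (trans (sym (xor-assoc a b _))
    (trans (cong₂ _xor_ (xor-comm a b) (pairSum-flip es (λ c d L → H c d (e ∷ L)) (unique-tail u))) (xor-assoc b a _)))
  (sym (pairSum-step e es (λ c d L → H d c L) u)))
  where
  a = Σ⊕ es (λ d → H e d (remove d es))
  b = Σ⊕ es (λ c → H c e (remove c es))

-- Each unordered pair is counted twice, so a symmetric summand sums to zero.
pairSum-symmetric : ∀ {n} (cs : List (Fin n)) H → Unique cs → (∀ c d L → H c d L ≡ H d c L) → pairSum cs H ≡ false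
pairSum-symmetric [] H u s = refl
pairSum-symmetric (e ∷ es) H u s = trans (pairSum-step e es H u)
  (trans (cong₂ (λ x y → x xor (b xor y))
            (Σ⊕-cong es (λ d _ → s e d _))
            (pairSum-symmetric es (λ c d L → H c d (e ∷ L)) (unique-tail u) (λ c d L → s c d _)))
     (trans (cong (b xor_) (xor-identityʳ b)) (xor-same b)))
  where
  b = Σ⊕ es (λ c → H c e (remove c es))

det-two-rows : ∀ {n} (M : Adj n) r₁ r₂ rs cs →
  detRC M (r₁ ∷ r₂ ∷ rs) cs ≡ pairSum cs (λ c d L → M r₁ c ∧ (M r₂ d ∧ detRC M rs L))
det-two-rows M r₁ r₂ rs cs = trans (det-cons M r₁ (r₂ ∷ rs) cs) (Σ⊕-cong cs (λ c _ →
  trans (cong (M r₁ c ∧_) (det-cons M r₂ rs (remove c cs))) (Σ⊕-scale (remove c cs) (M r₁ c) _)))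

-- Swapping the first two rows does not change the minor (there are no signs over GF(2)).
det-swap-rows : ∀ {n} (M : Adj n) r₁ r₂ rs cs → Unique cs →
  detRC M (r₁ ∷ r₂ ∷ rs) cs ≡ detRC M (r₂ ∷ r₁ ∷ rs) cs
det-swap-rows M r₁ r₂ rs cs u = trans (det-two-rows M r₁ r₂ rs cs)
  (trans (pairSum-flip cs (λ c d L → M r₁ c ∧ (M r₂ d ∧ detRC M rs L)) u)
  (trans (pairSum-cong cs (λ c d L → ∧-swap (M r₁ d) (M r₂ c) (detRC M rs L)))
  (sym (det-two-rows M r₂ r₁ rs cs))))

det-equal-rows : ∀ {n} (M : Adj n) r rs cs → Unique cs → detRC M (r ∷ r ∷ rs) cs ≡ false
det-equal-rows M r rs cs u = trans (det-two-rows M r r rs cs)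
  (pairSum-symmetric cs (λ c d L → M r c ∧ (M r d ∧ detRC M rs L)) u (λ c d L → ∧-swap (M r c) (M r d) _))

det-cons-cong : ∀ {n} (M : Adj n) r {rs rs′} → (∀ cs → Unique cs → detRC M rs cs ≡ detRC M rs′ cs) →
  ∀ cs → Unique cs → detRC M (r ∷ rs) cs ≡ detRC M (r ∷ rs′) cs
det-cons-cong M r {rs} {rs′} e cs u = trans (det-cons M r rs cs) (trans
  (Σ⊕-cong cs (λ d _ → cong (M r d ∧_) (e (remove d cs) (remove-unique d cs u)))) (sym (det-cons M r rs′ cs)))

det-permute-rows : ∀ {n} (M : Adj n) {rs rs′} → rs ↭ rs′ → ∀ cs → Unique cs → detRC M rs cs ≡ detRC M rs′ cs
det-permute-rows M ↭.refl cs u = refl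
det-permute-rows M (↭.prep x p) = det-cons-cong M x (det-permute-rows M p)
det-permute-rows M (↭.swap x y p) cs u =
  trans (det-swap-rows M x y _ cs u) (det-cons-cong M y (det-cons-cong M x (det-permute-rows M p)) cs u)
det-permute-rows M (↭.trans p q) cs u = trans (det-permute-rows M p cs u) (det-permute-rows M q cs u)

det-rename : ∀ {n} (M : Adj n) (σ : Fin n → Fin n) → (∀ x y → σ x ≡ σ y → x ≡ y) → ∀ rs cs →
  detRC M (map σ rs) (map σ cs) ≡ detRC (λ r c → M (σ r) (σ c)) rs cs
det-rename M σ σ-inj [] cs = refl
det-rename M σ σ-inj (r ∷ rs) cs = trans (det-cons M (σ r) (map σ rs) (map σ cs)) (trans (Σ⊕-map σ cs _)
  (trans (Σ⊕-cong cs (λ d _ → cong (M (σ r) (σ d) ∧_)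
    (trans (cong (detRC M (map σ rs)) (remove-map σ σ-inj d cs)) (det-rename M σ σ-inj rs (remove d cs)))))
  (sym (det-cons _ r rs cs))))

_ᵀ : ∀ {n} → Adj n → Adj n
(M ᵀ) r c = M c r

-- Transposition invariance for k × k minors; proved by induction on k below.
TransposeAt : ℕ → ℕ → Set
TransposeAt n k = ∀ (M : Adj n) rs cs → length rs ≡ k → length cs ≡ k → Unique rs → Unique cs →
  detRC M rs cs ≡ detRC (M ᵀ) cs rs

det-cons-col : ∀ {n} k → TransposeAt n (suc k) → TransposeAt n k →
  ∀ (M : Adj n) rs c cs → length rs ≡ suc k → length cs ≡ k → Unique rs → Unique (c ∷ cs) →
  detRC M rs (c ∷ cs) ≡ Σ⊕ rs (λ s → M s c ∧ detRC M (remove s rs) cs)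
det-cons-col k tr₁ tr₀ M rs c cs lr lc ur uc = trans (tr₁ M rs (c ∷ cs) lr (cong suc lc) ur uc)
  (trans (det-cons (M ᵀ) c cs rs)
    (Σ⊕-cong rs (λ s s∈ → cong (M s c ∧_) (sym (tr₀ M (remove s rs) cs (remove-length rs k s∈ lr) lc
        (remove-unique s rs ur) (unique-tail uc))))))

det-cons-cross : ∀ {n} k → TransposeAt n (suc k) → TransposeAt n k →
  ∀ (M : Adj n) r rs c cs → length rs ≡ suc k → length cs ≡ suc k → Unique rs → Unique (c ∷ cs) →
  detRC M (r ∷ rs) (c ∷ cs) ≡ (M r c ∧ detRC M rs cs) xor
     Σ⊕ cs (λ d → Σ⊕ rs (λ s → M r d ∧ (M s c ∧ detRC M (remove s rs) (remove d cs))))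
det-cons-cross k tr₁ tr₀ M r rs c cs lr lc ur uc = trans (det-cons M r rs (c ∷ cs)) (cong₂ _xor_
  (cong (λ L → M r c ∧ detRC M rs L) (remove-head c cs))
  (Σ⊕-cong cs (λ d d∈ → trans (cong (λ L → M r d ∧ detRC M rs L) (remove-skip cs (λ d≡c → unique-≢ uc d∈ (sym d≡c))))
     (trans (cong (M r d ∧_) (det-cons-col k tr₁ tr₀ M rs c (remove d cs) lr (remove-length cs k d∈ lc) ur
                                (unique-cons-remove d uc)))
        (Σ⊕-scale rs (M r d) _)))))
  where
  unique-cons-remove : ∀ d {c cs} → Unique (c ∷ cs) → Unique (c ∷ remove d cs)
  unique-cons-remove d {cs = cs} (c∉ ∷ u) = All.tabulate (λ x∈ → All.lookup c∉ (remove-⊆ cs x∈)) ∷ remove-unique d cs u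

-- The cross expansion is symmetric under transposition, which drives the induction.
det-transpose-at : ∀ {n} k → TransposeAt n k
det-transpose-at zero M [] [] lr lc ur uc = refl
det-transpose-at (suc zero) M (r ∷ []) (c ∷ []) lr lc ur uc = refl
det-transpose-at (suc (suc k)) M (r ∷ rs) (c ∷ cs) lr lc ur uc =
  trans (det-cons-cross k (det-transpose-at (suc k)) (det-transpose-at k) M r rs c cs lr′ lc′ (unique-tail ur) uc)
  (trans (cong₂ _xor_ (cong (M r c ∧_) (det-transpose-at (suc k) M rs cs lr′ lc′ (unique-tail ur) (unique-tail uc)))
     (trans (Σ⊕-swap cs rs _) (Σ⊕-cong rs (λ s s∈ → Σ⊕-cong cs (λ d d∈ →
        trans (∧-swap (M r d) (M s c) _) (cong (λ z → M s c ∧ (M r d ∧ z))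
          (det-transpose-at k M (remove s rs) (remove d cs) (remove-length rs k s∈ lr′) (remove-length cs k d∈ lc′)
             (remove-unique s rs (unique-tail ur)) (remove-unique d cs (unique-tail uc)))))))))
  (sym (det-cons-cross k (det-transpose-at (suc k)) (det-transpose-at k) (M ᵀ) c cs r rs lc′ lr′ (unique-tail uc) ur)))
  where
  lr′ = cong pred lr
  lc′ = cong pred lc

det-transpose : ∀ {n} (M : Adj n) rs cs → length rs ≡ length cs → Unique rs → Unique cs →
  detRC M rs cs ≡ detRC (M ᵀ) cs rs
det-transpose M rs cs e = det-transpose-at (length rs) M rs cs refl (sym e)

det-row-addition : ∀ {n} (M M′ : Adj n) w L (λ′ : Fin n → Bool) →
  (∀ c → M′ w c ≡ M w c) → (∀ r → r ∈ L → ∀ c → M′ r c ≡ M r c xor (λ′ r ∧ M w c)) →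
  ∀ K → Unique K → detRC M′ (w ∷ L) K ≡ detRC M (w ∷ L) K
det-row-addition M M′ w [] λ′ hw hL K u = det-cong (w ∷ []) K (λ { r c (here refl) _ → hw c })
det-row-addition M M′ w (r ∷ L) λ′ hw hL K u = begin
  detRC M′ (w ∷ r ∷ L) K
    ≡⟨ det-swap-rows M′ w r L K u ⟩
  detRC M′ (r ∷ w ∷ L) K
    ≡⟨ det-cons M′ r (w ∷ L) K ⟩
  Σ⊕ K (λ d → M′ r d ∧ detRC M′ (w ∷ L) (remove d K))
    ≡⟨ Σ⊕-cong K (λ d _ → cong₂ _∧_ (hL r (here refl) d)
         (det-row-addition M M′ w L λ′ hw (λ r′ r′∈ → hL r′ (there r′∈)) (remove d K) (remove-unique d K u))) ⟩
  Σ⊕ K (λ d → (M r d xor (λ′ r ∧ M w d)) ∧ detRC M (w ∷ L) (remove d K))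
    ≡⟨ Σ⊕-cong K (λ d _ → trans (∧-distribʳ-xor _ (M r d) (λ′ r ∧ M w d)) (cong ((M r d ∧ detRC M (w ∷ L) (remove d K)) xor_) (∧-assoc (λ′ r) (M w d) _))) ⟩
  Σ⊕ K (λ d → (M r d ∧ detRC M (w ∷ L) (remove d K)) xor (λ′ r ∧ (M w d ∧ detRC M (w ∷ L) (remove d K))))
    ≡⟨ Σ⊕-xor K _ _ ⟩
  Σ⊕ K (λ d → M r d ∧ detRC M (w ∷ L) (remove d K)) xor Σ⊕ K (λ d → λ′ r ∧ (M w d ∧ detRC M (w ∷ L) (remove d K)))
    ≡⟨ cong₂ _xor_ (sym (det-cons M r (w ∷ L) K)) (sym (Σ⊕-scale K (λ′ r) _)) ⟩
  detRC M (r ∷ w ∷ L) K xor (λ′ r ∧ Σ⊕ K (λ d → M w d ∧ detRC M (w ∷ L) (remove d K)))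
    ≡⟨ cong (λ z → detRC M (r ∷ w ∷ L) K xor (λ′ r ∧ z)) (trans (sym (det-cons M w (w ∷ L) K)) (det-equal-rows M w L K u)) ⟩
  detRC M (r ∷ w ∷ L) K xor (λ′ r ∧ false)
    ≡⟨ trans (cong (detRC M (r ∷ w ∷ L) K xor_) (∧-zeroʳ (λ′ r))) (xor-identityʳ _) ⟩
  detRC M (r ∷ w ∷ L) K
    ≡⟨ det-swap-rows M r w L K u ⟩
  detRC M (w ∷ r ∷ L) K ∎
  where open ≡-Reasoning

det-column-addition : ∀ {n} (M M′ : Adj n) w K (λ′ : Fin n → Bool) →
  (∀ r → M′ r w ≡ M r w) → (∀ c → c ∈ K → ∀ r → M′ r c ≡ M r c xor (λ′ c ∧ M r w)) →
  ∀ R → Unique R → Unique (w ∷ K) → length R ≡ length (w ∷ K) → detRC M′ R (w ∷ K) ≡ detRC M R (w ∷ K)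
det-column-addition M M′ w K λ′ hw hK R uR uK e = begin
  detRC M′ R (w ∷ K)        ≡⟨ det-transpose M′ R (w ∷ K) e uR uK ⟩
  detRC (M′ ᵀ) (w ∷ K) R    ≡⟨ det-row-addition (M ᵀ) (M′ ᵀ) w K λ′ hw hK R uR ⟩
  detRC (M ᵀ) (w ∷ K) R     ≡⟨ sym (det-transpose M R (w ∷ K) e uR uK) ⟩
  detRC M R (w ∷ K)         ∎
  where open ≡-Reasoning

schur : ∀ {n} → Adj n → Fin n → Fin n → Adj n
schur M p q r c = M r c xor (M r q ∧ M p c)

det-schur : ∀ {n} (M : Adj n) p q R C → M p q ≡ true → Unique (p ∷ R) → Unique (q ∷ C) → length R ≡ length C →
  detRC M (p ∷ R) (q ∷ C) ≡ detRC (schur M p q) R C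
det-schur M p q R C Mpq≡1 uR uC e = begin
  detRC M (p ∷ R) (q ∷ C)
    ≡⟨ sym (det-column-addition M M′ q C (M p) (λ r → M′-q r) (λ c c∈ r → M′-off (q≢ c∈) r) (p ∷ R) uR uC (cong suc e)) ⟩
  detRC M′ (p ∷ R) (q ∷ C)
    ≡⟨ det-cons M′ p R (q ∷ C) ⟩
  Σ⊕ (q ∷ C) (λ d → M′ p d ∧ detRC M′ R (remove d (q ∷ C)))
    ≡⟨ Σ⊕-single (q ∷ C) _ q uC (here refl) row-p-vanishes ⟩
  M′ p q ∧ detRC M′ R (remove q (q ∷ C))
    ≡⟨ cong₂ _∧_ (trans (M′-q p) Mpq≡1) (cong (detRC M′ R) (remove-head q C)) ⟩
  detRC M′ R C
    ≡⟨ det-cong R C (λ r c _ c∈ → trans (M′-off (q≢ c∈) r) (cong (M r c xor_) (∧-comm (M p c) (M r q)))) ⟩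
  detRC (schur M p q) R C ∎
  where
  open ≡-Reasoning
  -- clear row p outside column q by adding multiples of column q
  M′ : Adj _
  M′ r c = if c == q then M r c else M r c xor (M p c ∧ M r q)
  M′-q : ∀ r → M′ r q ≡ M r q
  M′-q r rewrite ==-refl q = refl
  M′-off : ∀ {c} → c ≢ q → ∀ r → M′ r c ≡ M r c xor (M p c ∧ M r q)
  M′-off c≢q r rewrite ==-no c≢q = refl
  q≢ : ∀ {c} → c ∈ C → c ≢ q
  q≢ c∈ c≡q = unique-≢ uC c∈ (sym c≡q)
  row-p-vanishes : ∀ d → d ∈ q ∷ C → d ≢ q → M′ p d ∧ detRC M′ R (remove d (q ∷ C)) ≡ false
  row-p-vanishes d _ d≢q rewrite M′-off d≢q p | Mpq≡1 | ∧-identityʳ (M p d) | xor-same (M p d) = refl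

det-schur-block : ∀ {n} (M : Adj n) p q L → M p p ≡ false → M q q ≡ false → M p q ≡ true → M q p ≡ true →
  Unique (p ∷ q ∷ L) →
  detRC M (p ∷ q ∷ L) (p ∷ q ∷ L) ≡ detRC (λ r c → M r c xor ((M r q ∧ M p c) xor (M r p ∧ M q c))) L L
det-schur-block M p q L Mpp≡0 Mqq≡0 Mpq≡1 Mqp≡1 u@((p≢q ∷ p∉) ∷ q∉ ∷ uL) = begin
  detRC M (p ∷ q ∷ L) (p ∷ q ∷ L)
    ≡⟨ det-permute-cols M (p ∷ q ∷ L) (↭.swap p q ↭.refl) ⟩
  detRC M (p ∷ q ∷ L) (q ∷ p ∷ L)
    ≡⟨ det-schur M p q (q ∷ L) (p ∷ L) Mpq≡1 u (((λ q≡p → p≢q (sym q≡p)) ∷ q∉) ∷ p∉ ∷ uL) refl ⟩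
  detRC S (q ∷ L) (p ∷ L)
    ≡⟨ det-schur S q p L L (trans (cong (λ z → M q p xor (z ∧ M p p)) Mqq≡0) (trans (xor-identityʳ (M q p)) Mqp≡1)) (q∉ ∷ uL) (p∉ ∷ uL) refl ⟩
  detRC (schur S q p) L L
    ≡⟨ det-cong L L (λ r c _ _ → entry r c) ⟩
  detRC (λ r c → M r c xor ((M r q ∧ M p c) xor (M r p ∧ M q c))) L L ∎
  where
  open ≡-Reasoning
  S = schur M p q
  entry : ∀ r c → schur S q p r c ≡ M r c xor ((M r q ∧ M p c) xor (M r p ∧ M q c))
  entry r c rewrite Mpp≡0 | Mqq≡0 | ∧-zeroʳ (M r q) | xor-identityʳ (M r p) | xor-identityʳ (M q c) =
    xor-assoc (M r c) (M r q ∧ M p c) (M r p ∧ M q c)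

det-principal-perm : ∀ {n} (M : Adj n) {xs ys} → xs ↭ ys → Unique xs → detRC M xs xs ≡ detRC M ys ys
det-principal-perm M {xs} {ys} p u = trans (det-permute-rows M p xs u) (det-permute-cols M ys p)

congruent : ∀ {n} → Adj n → Fin n → (Fin n → Bool) → Adj n
congruent M w λ′ r c = M r c xor ((λ′ r ∧ M w c) xor (λ′ c ∧ M r w))

module _ {n} (M : Adj n) (w : Fin n) (λ′ : Fin n → Bool) (λ′w≡0 : λ′ w ≡ false) (Mww≡0 : M w w ≡ false) where

  congruent-row : ∀ c → congruent M w λ′ w c ≡ M w c
  congruent-row c rewrite λ′w≡0 | Mww≡0 | ∧-zeroʳ (λ′ c) = xor-identityʳ (M w c)

  congruent-col : ∀ r → congruent M w λ′ r w ≡ M r w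
  congruent-col r rewrite λ′w≡0 | Mww≡0 | ∧-zeroʳ (λ′ r) = xor-identityʳ (M r w)

  -- The congruence is a row addition followed by a column addition, so it preserves the minor.
  det-congruent : ∀ L → Unique (w ∷ L) → detRC M (w ∷ L) (w ∷ L) ≡ detRC (congruent M w λ′) (w ∷ L) (w ∷ L)
  det-congruent L u = begin
    detRC M (w ∷ L) (w ∷ L)
      ≡⟨ sym (det-row-addition M N w L λ′ N-row (λ r _ c → refl) (w ∷ L) u) ⟩
    detRC N (w ∷ L) (w ∷ L)
      ≡⟨ sym (det-column-addition N (congruent M w λ′) w L λ′ (λ r → trans (congruent-col r) (sym (N-col r)))
                (λ c _ r → column-step r c) (w ∷ L) u u refl) ⟩
    detRC (congruent M w λ′) (w ∷ L) (w ∷ L) ∎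
    where
    open ≡-Reasoning
    N : Adj n
    N r c = M r c xor (λ′ r ∧ M w c)
    N-row : ∀ c → N w c ≡ M w c
    N-row c rewrite λ′w≡0 = xor-identityʳ (M w c)
    N-col : ∀ r → N r w ≡ M r w
    N-col r rewrite Mww≡0 | ∧-zeroʳ (λ′ r) = xor-identityʳ (M r w)
    column-step : ∀ r c → congruent M w λ′ r c ≡ N r c xor (λ′ c ∧ N r w)
    column-step r c rewrite N-col r = sym (xor-assoc (M r c) (λ′ r ∧ M w c) (λ′ c ∧ M r w))

-- The members of X among xs, in the order of xs; elems X is the case xs = allFin n.
select : ∀ {n} → VSet n → List (Fin n) → List (Fin n)
select X = filter (λ z → X z ≟ᴮ true)

select-∷ : ∀ {n} (X : VSet n) y ys → select X (y ∷ ys) ≡ (if X y then y ∷ select X ys else select X ys)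
select-∷ X y ys with X y
... | true = refl
... | false = refl

select-cong : ∀ {n} (X Y : VSet n) xs → (∀ z → z ∈ xs → X z ≡ Y z) → select X xs ≡ select Y xs
select-cong X Y [] e = refl
select-cong X Y (y ∷ ys) e
  rewrite select-∷ X y ys | select-∷ Y y ys | e y (here refl) | select-cong X Y ys (λ z z∈ → e z (there z∈)) = refl

select-insert : ∀ {n} (X Y : VSet n) x → X x ≡ true → Y x ≡ false → (∀ z → z ≢ x → X z ≡ Y z) →
  ∀ xs → Unique xs → x ∈ xs → select X xs ↭ x ∷ select Y xs
select-insert X Y x Xx Yx X≐Y (.x ∷ ys) u (here refl)
  rewrite select-∷ X x ys | select-∷ Y x ys | Xx | Yx =
  ↭.prep x (↭.↭-reflexive (select-cong X Y ys (λ z z∈ → X≐Y z (λ z≡x → unique-head u (subst (_∈ ys) z≡x z∈)))))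
select-insert X Y x Xx Yx X≐Y (y ∷ ys) u (there x∈)
  rewrite select-∷ X y ys | select-∷ Y y ys | X≐Y y (unique-≢ u x∈) with Y y
... | true = ↭.trans (↭.prep y (select-insert X Y x Xx Yx X≐Y ys (unique-tail u) x∈)) (↭.swap y x ↭.refl)
... | false = select-insert X Y x Xx Yx X≐Y ys (unique-tail u) x∈

elems-insert : ∀ {n} (X Y : VSet n) x → X x ≡ true → Y x ≡ false → (∀ z → z ≢ x → X z ≡ Y z) →
  elems X ↭ x ∷ elems Y
elems-insert {n} X Y x Xx Yx X≐Y = select-insert X Y x Xx Yx X≐Y (allFin n) (allFin⁺ n) (∈-allFin x)

elems-cong : ∀ {n} (X Y : VSet n) → (∀ z → X z ≡ Y z) → elems X ≡ elems Y
elems-cong {n} X Y e = select-cong X Y (allFin n) (λ z _ → e z)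

elems-unique : ∀ {n} (X : VSet n) → Unique (elems X)
elems-unique {n} X = filter⁺ (λ z → X z ≟ᴮ true) (allFin⁺ n)

elems-member : ∀ {n} (X : VSet n) {z} → z ∈ elems X → X z ≡ true
elems-member {n} X z∈ = proj₂ (∈-filter⁻ (λ z → X z ≟ᴮ true) {xs = allFin n} z∈)

elems-avoid : ∀ {n} (X : VSet n) {x z} → X x ≡ false → z ∈ elems X → z ≢ x
elems-avoid X Xx≡0 z∈ refl with trans (sym (elems-member X z∈)) Xx≡0
... | ()

elems-empty : ∀ {n} → elems {n} (λ _ → false) ≡ []
elems-empty {n} = none (allFin n)
  where
  none : (xs : List (Fin n)) → select (λ _ → false) xs ≡ []
  none [] = refl
  none (x ∷ xs) = none xs

class : Bool → Bool → Cls
class true false = c1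
class false true = c2
class true true = c3
class false false = c0

cls≡class : ∀ {n} (A : Adj n) u v x → cls A u v x ≡ class (N' A u x) (N' A v x)
cls≡class A u v x with N' A u x | N' A v x
... | true | false = refl
... | false | true = refl
... | true | true = refl
... | false | false = refl

toggle-class : ∀ p q r s → toggle (class p q) (class r s) ≡ (p ∧ s) xor (q ∧ r)
toggle-class true true true true = refl
toggle-class true true true false = refl
toggle-class true true false true = refl
toggle-class true true false false = refl
toggle-class true false true true = refl
toggle-class true false true false = refl
toggle-class true false false true = refl
toggle-class true false false false = refl
toggle-class false true true true = refl
toggle-class false true true false = refl
toggle-class false true false true = refl
toggle-class false true false false = refl
toggle-class false false true true = refl
toggle-class false false true false = refl
toggle-class false false false true = refl
toggle-class false false false false = refl

pivot-formula : ∀ {n} (A : Adj n) u v x y →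
  pivot A u v x y ≡ A x y xor ((N' A u x ∧ N' A v y) xor (N' A v x ∧ N' A u y))
pivot-formula A u v x y = cong (A x y xor_) (trans (cong₂ toggle (cls≡class A u v x) (cls≡class A u v y))
  (toggle-class (N' A u x) (N' A v x) (N' A u y) (N' A v y)))

pivot-comm : ∀ {n} (A : Adj n) u v x y → pivot A u v x y ≡ pivot A v u x y
pivot-comm A u v x y = begin
  pivot A u v x y                                                     ≡⟨ pivot-formula A u v x y ⟩
  A x y xor ((N' A u x ∧ N' A v y) xor (N' A v x ∧ N' A u y))         ≡⟨ cong (A x y xor_) (xor-comm (N' A u x ∧ N' A v y) (N' A v x ∧ N' A u y)) ⟩
  A x y xor ((N' A v x ∧ N' A u y) xor (N' A u x ∧ N' A v y))         ≡⟨ sym (pivot-formula A v u x y) ⟩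
  pivot A v u x y                                                     ∎
  where open ≡-Reasoning

-- G[uv] is simple again: the formula is symmetric in x, y and vanishes on the diagonal.
pivot-simple : ∀ {n} (A : Adj n) u v → IsSimple A → IsSimple (pivot A u v)
pivot-simple A u v (symmetric , loopless) = pivot-symmetric , pivot-loopless
  where
  a = N' A u
  b = N' A v
  pivot-symmetric : ∀ x y → pivot A u v x y ≡ pivot A u v y x
  pivot-symmetric x y = begin
    pivot A u v x y                                     ≡⟨ pivot-formula A u v x y ⟩
    A x y xor ((a x ∧ b y) xor (b x ∧ a y))             ≡⟨ cong₂ _xor_ (symmetric x y) (cong₂ _xor_ (∧-comm (a x) (b y)) (∧-comm (b x) (a y))) ⟩
    A y x xor ((b y ∧ a x) xor (a y ∧ b x))             ≡⟨ cong (A y x xor_) (xor-comm (b y ∧ a x) (a y ∧ b x)) ⟩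
    A y x xor ((a y ∧ b x) xor (b y ∧ a x))             ≡⟨ sym (pivot-formula A u v y x) ⟩
    pivot A u v y x                                     ∎
    where open ≡-Reasoning
  pivot-loopless : ∀ x → pivot A u v x x ≡ false
  pivot-loopless x rewrite pivot-formula A u v x x | loopless x | ∧-comm (a x) (b x) = xor-same (b x ∧ a x)

applySeq-simple : ∀ {n} (A : Adj n) φ → IsSimple A → IsSimple (applySeq A φ)
applySeq-simple A [] s = s
applySeq-simple A ((u , v) ∷ φ) s = applySeq-simple (pivot A u v) φ (pivot-simple A u v s)

N'-self : ∀ {n} (A : Adj n) u → N' A u u ≡ true
N'-self A u rewrite ==-refl u = refl

N'-other : ∀ {n} (A : Adj n) u {x} → x ≢ u → N' A u x ≡ A u x
N'-other A u x≢u rewrite ==-no x≢u = refl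

module PivotOnEdge {n} (A : Adj n) (simple : IsSimple A) {u v : Fin n} (uv : A u v ≡ true) where
  private
    symmetric = proj₁ simple
    loopless = proj₂ simple
    Pv = pivot A u v

  vu : A v u ≡ true
  vu = trans (symmetric v u) uv

  u≢v : u ≢ v
  u≢v refl with trans (sym uv) (loopless u)
  ... | ()

  pivot-N'-u : ∀ x → N' Pv u x ≡ N' A v x
  pivot-N'-u x = by-cases (x ≟ u)
    where
    by-cases : Dec (x ≡ u) → N' Pv u x ≡ N' A v x
    by-cases (yes refl) = trans (N'-self Pv u) (sym (trans (N'-other A v u≢v) vu))
    by-cases (no x≢u) = begin
      N' Pv u x                                                     ≡⟨ N'-other Pv u x≢u ⟩
      Pv u x                                                        ≡⟨ pivot-formula A u v u x ⟩
      A u x xor ((N' A u u ∧ N' A v x) xor (N' A v u ∧ N' A u x))   ≡⟨ cong₂ (λ p q → A u x xor ((p ∧ N' A v x) xor (q ∧ N' A u x)))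
                                                                          (N'-self A u) (trans (N'-other A v u≢v) vu) ⟩
      A u x xor (N' A v x xor N' A u x)                             ≡⟨ cong (λ z → A u x xor (N' A v x xor z)) (N'-other A u x≢u) ⟩
      A u x xor (N' A v x xor A u x)                                ≡⟨ xor-absorb (A u x) (N' A v x) ⟩
      N' A v x                                                      ∎
      where open ≡-Reasoning

  -- Away from u and v, G[uv] is the Schur complement of the block on {u, v}.
  pivot-off : ∀ {r c} → r ≢ u → r ≢ v → c ≢ u → c ≢ v →
    Pv r c ≡ A r c xor ((A r v ∧ A u c) xor (A r u ∧ A v c))
  pivot-off {r} {c} r≢u r≢v c≢u c≢v
    rewrite pivot-formula A u v r c | N'-other A u r≢u | N'-other A v r≢v | N'-other A u c≢u | N'-other A v c≢v
          | symmetric u r | symmetric v r =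
    cong (A r c xor_) (xor-comm (A r u ∧ A v c) (A r v ∧ A u c))

  -- If u, v ∉ Y: eliminate the block [[0,1],[1,0]] of G|_{Y ∪ {u,v}} on {u, v}.
  det-pivot-outside : ∀ Y → Y u ≡ false → Y v ≡ false → detInduced Pv Y ≡ detInduced A (Y ⊕ pair u v)
  det-pivot-outside Y Yu≡0 Yv≡0 = begin
    detRC Pv L L
      ≡⟨ det-cong L L (λ r c r∈ c∈ → pivot-off (elems-avoid Y Yu≡0 r∈) (elems-avoid Y Yv≡0 r∈)
                                                (elems-avoid Y Yu≡0 c∈) (elems-avoid Y Yv≡0 c∈)) ⟩
    detRC (λ r c → A r c xor ((A r v ∧ A u c) xor (A r u ∧ A v c))) L L
      ≡⟨ sym (det-schur-block A u v L (loopless u) (loopless v) uv vu uvL) ⟩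
    detRC A (u ∷ v ∷ L) (u ∷ v ∷ L)
      ≡⟨ sym (det-principal-perm A elems-X (elems-unique X)) ⟩
    detRC A (elems X) (elems X) ∎
    where
    open ≡-Reasoning
    L = elems Y
    X = Y ⊕ pair u v
    Y+v : VSet n
    Y+v z = (z == v) ∨ Y z
    uvL : Unique (u ∷ v ∷ L)
    uvL = (u≢v ∷ All.tabulate (λ z∈ u≡z → elems-avoid Y Yu≡0 z∈ (sym u≡z)))
        ∷ All.tabulate (λ z∈ v≡z → elems-avoid Y Yv≡0 z∈ (sym v≡z)) ∷ elems-unique Y
    Xu≡1 : X u ≡ true
    Xu≡1 rewrite Yu≡0 | ==-refl u = refl
    Y+v-u≡0 : Y+v u ≡ false
    Y+v-u≡0 rewrite ==-no u≢v = Yu≡0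
    X≐Y+v : ∀ z → z ≢ u → X z ≡ Y+v z
    X≐Y+v z z≢u = by-cases (z ≟ v)
      where
      by-cases : Dec (z ≡ v) → X z ≡ Y+v z
      by-cases (yes refl) rewrite ==-no z≢u | ==-refl z | Yv≡0 = refl
      by-cases (no z≢v) rewrite ==-no z≢u | ==-no z≢v = xor-identityʳ (Y z)
    elems-X : elems X ↭ u ∷ v ∷ L
    elems-X = ↭.trans
      (elems-insert X Y+v u Xu≡1 Y+v-u≡0 X≐Y+v)
      (↭.prep u (elems-insert Y+v Y v (cong (_∨ Y v) (==-refl v)) Yv≡0 (λ z z≢v → cong (_∨ Y z) (==-no z≢v))))

  σ : Fin n → Fin n
  σ = transpose u v

  σ-u : σ u ≡ v
  σ-u rewrite dec-true (u ≟ u) refl = refl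

  σ-other : ∀ {z} → z ≢ u → z ≢ v → σ z ≡ z
  σ-other {z} z≢u z≢v rewrite dec-false (z ≟ u) z≢u | dec-false (z ≟ v) z≢v = refl

  σ-injective : ∀ x y → σ x ≡ σ y → x ≡ y
  σ-injective x y σx≡σy = trans (sym (transpose-inverse v u)) (trans (cong (transpose v u) σx≡σy) (transpose-inverse v u))

  λ′ : Fin n → Bool
  λ′ z = A u z ∧ not (z == v)

  λ′v≡0 : λ′ v ≡ false
  λ′v≡0 rewrite ==-refl v = ∧-zeroʳ (A u v)

  C : Adj n
  C = congruent A v λ′

  C-renamed : ∀ {L} → (∀ {z} → z ∈ L → z ≢ u) → (∀ {z} → z ∈ L → z ≢ v) →
    ∀ r c → r ∈ u ∷ L → c ∈ u ∷ L → C (σ r) (σ c) ≡ Pv r c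
  C-renamed L∌u L∌v r c (here refl) (here refl) rewrite σ-u =
    trans (congruent-row A v λ′ λ′v≡0 (loopless v) v) (trans (loopless v) (sym (proj₂ (pivot-simple A u v simple) u)))
  C-renamed L∌u L∌v r c (here refl) (there c∈) rewrite σ-u | σ-other (L∌u c∈) (L∌v c∈) = begin
    C v c         ≡⟨ congruent-row A v λ′ λ′v≡0 (loopless v) c ⟩
    A v c         ≡⟨ sym (N'-other A v (L∌v c∈)) ⟩
    N' A v c      ≡⟨ sym (pivot-N'-u c) ⟩
    N' Pv u c     ≡⟨ N'-other Pv u (L∌u c∈) ⟩
    Pv u c        ∎
    where open ≡-Reasoning
  C-renamed L∌u L∌v r c (there r∈) (here refl) rewrite σ-u | σ-other (L∌u r∈) (L∌v r∈) = begin
    C r v         ≡⟨ congruent-col A v λ′ λ′v≡0 (loopless v) r ⟩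
    A r v         ≡⟨ symmetric r v ⟩
    A v r         ≡⟨ sym (N'-other A v (L∌v r∈)) ⟩
    N' A v r      ≡⟨ sym (pivot-N'-u r) ⟩
    N' Pv u r     ≡⟨ N'-other Pv u (L∌u r∈) ⟩
    Pv u r        ≡⟨ proj₁ (pivot-simple A u v simple) u r ⟩
    Pv r u        ∎
    where open ≡-Reasoning
  C-renamed L∌u L∌v r c (there r∈) (there c∈)
    rewrite σ-other (L∌u r∈) (L∌v r∈) | σ-other (L∌u c∈) (L∌v c∈)
          | pivot-off (L∌u r∈) (L∌v r∈) (L∌u c∈) (L∌v c∈)
          | ==-no (L∌v r∈) | ==-no (L∌v c∈) | ∧-identityʳ (A u r) | ∧-identityʳ (A u c)
          | symmetric u r | ∧-comm (A u c) (A r v) =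
    cong (A r c xor_) (xor-comm (A r u ∧ A v c) (A r v ∧ A u c))

  _∖u : VSet n → VSet n
  (Y ∖u) z = Y z ∧ not (z == u)

  Y∖u-u≡0 : ∀ Y → (Y ∖u) u ≡ false
  Y∖u-u≡0 Y rewrite ==-refl u = ∧-zeroʳ (Y u)

  Y∖u-v≡0 : ∀ Y → Y v ≡ false → (Y ∖u) v ≡ false
  Y∖u-v≡0 Y Yv≡0 rewrite Yv≡0 = refl

  elems-one-end : ∀ Y → Y u ≡ true → Y v ≡ false →
    (elems Y ↭ u ∷ elems (Y ∖u)) × (elems (Y ⊕ pair u v) ↭ v ∷ elems (Y ∖u))
  elems-one-end Y Yu≡1 Yv≡0 =
      elems-insert Y (Y ∖u) u Yu≡1 (Y∖u-u≡0 Y) (λ z z≢u → sym (trans (cong (λ b → Y z ∧ not b) (==-no z≢u)) (∧-identityʳ (Y z))))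
    , elems-insert (Y ⊕ pair u v) (Y ∖u) v Xv≡1 (Y∖u-v≡0 Y Yv≡0) X≐Y∖u
    where
    Xv≡1 : (Y ⊕ pair u v) v ≡ true
    Xv≡1 rewrite Yv≡0 | ==-no (λ v≡u → u≢v (sym v≡u)) | ==-refl v = refl
    X≐Y∖u : ∀ z → z ≢ v → (Y ⊕ pair u v) z ≡ (Y ∖u) z
    X≐Y∖u z z≢v = by-cases (z ≟ u)
      where
      by-cases : Dec (z ≡ u) → (Y ⊕ pair u v) z ≡ (Y ∖u) z
      by-cases (yes refl) rewrite ==-refl z | Yu≡1 = refl
      by-cases (no z≢u) rewrite ==-no z≢u | ==-no z≢v = trans (xor-identityʳ (Y z)) (sym (∧-identityʳ (Y z)))

  -- If u ∈ Y and v ∉ Y: G|_{Y ⊕ {u,v}} is congruent to G[uv]|_Y after renaming v to u.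
  det-pivot-one-end : ∀ Y → Y u ≡ true → Y v ≡ false → detInduced Pv Y ≡ detInduced A (Y ⊕ pair u v)
  det-pivot-one-end Y Yu≡1 Yv≡0 = begin
    detRC Pv (elems Y) (elems Y)
      ≡⟨ det-principal-perm Pv (proj₁ elems-Y-X) (elems-unique Y) ⟩
    detRC Pv (u ∷ L) (u ∷ L)
      ≡⟨ sym (det-cong (u ∷ L) (u ∷ L) (C-renamed L∌u L∌v)) ⟩
    detRC (λ r c → C (σ r) (σ c)) (u ∷ L) (u ∷ L)
      ≡⟨ sym (det-rename C σ σ-injective (u ∷ L) (u ∷ L)) ⟩
    detRC C (map σ (u ∷ L)) (map σ (u ∷ L))
      ≡⟨ cong (λ K → detRC C K K) (cong₂ _∷_ σ-u (fixed L L∌u L∌v)) ⟩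
    detRC C (v ∷ L) (v ∷ L)
      ≡⟨ sym (det-congruent A v λ′ λ′v≡0 (loopless v) L vL) ⟩
    detRC A (v ∷ L) (v ∷ L)
      ≡⟨ sym (det-principal-perm A (proj₂ elems-Y-X) (elems-unique (Y ⊕ pair u v))) ⟩
    detRC A (elems (Y ⊕ pair u v)) (elems (Y ⊕ pair u v)) ∎
    where
    open ≡-Reasoning
    L = elems (Y ∖u)
    elems-Y-X = elems-one-end Y Yu≡1 Yv≡0
    L∌u : ∀ {z} → z ∈ L → z ≢ u
    L∌u = elems-avoid (Y ∖u) (Y∖u-u≡0 Y)
    L∌v : ∀ {z} → z ∈ L → z ≢ v
    L∌v = elems-avoid (Y ∖u) (Y∖u-v≡0 Y Yv≡0)
    vL : Unique (v ∷ L)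
    vL = All.tabulate (λ z∈ v≡z → L∌v z∈ (sym v≡z)) ∷ elems-unique (Y ∖u)
    fixed : ∀ xs → (∀ {z} → z ∈ xs → z ≢ u) → (∀ {z} → z ∈ xs → z ≢ v) → map σ xs ≡ xs
    fixed [] _ _ = refl
    fixed (x ∷ xs) ∌u ∌v = cong₂ _∷_ (σ-other (∌u (here refl)) (∌v (here refl))) (fixed xs (λ z∈ → ∌u (there z∈)) (λ z∈ → ∌v (there z∈)))

detInduced-cong : ∀ {n} {M N : Adj n} {X Y : VSet n} → (∀ r c → M r c ≡ N r c) → (∀ z → X z ≡ Y z) →
  detInduced M X ≡ detInduced N Y
detInduced-cong {M = M} {N} {X} {Y} M≐N X≐Y =
  trans (cong (λ K → detRC M K K) (elems-cong X Y X≐Y)) (det-cong (elems Y) (elems Y) (λ r c _ _ → M≐N r c))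

pivot-N'-v : ∀ {n} (A : Adj n) → IsSimple A → ∀ {u v} → A u v ≡ true → ∀ x → N' (pivot A u v) v x ≡ N' A u x
pivot-N'-v A simple {u} {v} uv x =
  trans (cong ((x == v) ∨_) (pivot-comm A u v v x)) (PivotOnEdge.pivot-N'-u A simple (PivotOnEdge.vu A simple uv) x)

pivot-edge : ∀ {n} (A : Adj n) → IsSimple A → ∀ {u v} → A u v ≡ true → pivot A u v u v ≡ true
pivot-edge A simple {u} {v} uv = begin
  pivot A u v u v          ≡⟨ sym (N'-other (pivot A u v) u v≢u) ⟩
  N' (pivot A u v) u v     ≡⟨ PivotOnEdge.pivot-N'-u A simple uv v ⟩
  N' A v v                 ≡⟨ N'-self A v ⟩
  true                     ∎
  where
  open ≡-Reasoning
  v≢u : v ≢ u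
  v≢u v≡u = PivotOnEdge.u≢v A simple uv (sym v≡u)

pivot-involutive : ∀ {n} (A : Adj n) → IsSimple A → ∀ {u v} → A u v ≡ true → ∀ x y → pivot (pivot A u v) u v x y ≡ A x y
pivot-involutive A simple {u} {v} uv x y = begin
  pivot (pivot A u v) u v x y
    ≡⟨ pivot-formula (pivot A u v) u v x y ⟩
  pivot A u v x y xor ((N' (pivot A u v) u x ∧ N' (pivot A u v) v y) xor (N' (pivot A u v) v x ∧ N' (pivot A u v) u y))
    ≡⟨ cong (pivot A u v x y xor_) (cong₂ _xor_ (cong₂ _∧_ (N'u x) (N'v y)) (cong₂ _∧_ (N'v x) (N'u y))) ⟩
  pivot A u v x y xor ((b x ∧ a y) xor (a x ∧ b y))
    ≡⟨ cong₂ _xor_ (pivot-formula A u v x y) (xor-comm (b x ∧ a y) (a x ∧ b y)) ⟩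
  (A x y xor ((a x ∧ b y) xor (b x ∧ a y))) xor ((a x ∧ b y) xor (b x ∧ a y))
    ≡⟨ xor-cancelʳ (A x y) _ ⟩
  A x y ∎
  where
  open ≡-Reasoning
  a = N' A u
  b = N' A v
  N'u = PivotOnEdge.pivot-N'-u A simple uv
  N'v = pivot-N'-v A simple uv

pair-comm : ∀ {n} (u v z : Fin n) → pair u v z ≡ pair v u z
pair-comm u v z = ∨-comm (z == u) (z == v)

det-pivot : ∀ {n} (A : Adj n) → IsSimple A → ∀ {u v} → A u v ≡ true → ∀ Y →
  detInduced (pivot A u v) Y ≡ detInduced A (Y ⊕ pair u v)
det-pivot A simple {u} {v} uv Y = by-cases (Y u) (Y v) refl refl
  where
  open PivotOnEdge A simple uv
  Pv = pivot A u v
  by-cases : ∀ p q → Y u ≡ p → Y v ≡ q → detInduced Pv Y ≡ detInduced A (Y ⊕ pair u v)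
  by-cases false false Yu Yv = det-pivot-outside Y Yu Yv
  by-cases true false Yu Yv = det-pivot-one-end Y Yu Yv
  -- the roles of u and v are symmetric
  by-cases false true Yu Yv = begin
    detInduced Pv Y                  ≡⟨ detInduced-cong (pivot-comm A u v) (λ _ → refl) ⟩
    detInduced (pivot A v u) Y       ≡⟨ PivotOnEdge.det-pivot-one-end A simple vu Y Yv Yu ⟩
    detInduced A (Y ⊕ pair v u)      ≡⟨ detInduced-cong (λ _ _ → refl) (λ z → cong (Y z xor_) (pair-comm v u z)) ⟩
    detInduced A (Y ⊕ pair u v)      ∎
    where open ≡-Reasoning
  -- the outside case for G[uv] and Y ⊕ {u,v}, using that the pivot is an involution
  by-cases true true Yu Yv = begin
    detInduced Pv Y                          ≡⟨ detInduced-cong (λ _ _ → refl) (λ z → sym (xor-cancelʳ (Y z) (pair u v z))) ⟩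
    detInduced Pv (Y′ ⊕ pair u v)            ≡⟨ sym (PivotOnEdge.det-pivot-outside Pv (pivot-simple A u v simple) (pivot-edge A simple uv) Y′ Y′u Y′v) ⟩
    detInduced (pivot Pv u v) Y′             ≡⟨ detInduced-cong (pivot-involutive A simple uv) (λ _ → refl) ⟩
    detInduced A (Y ⊕ pair u v)              ∎
    where
    open ≡-Reasoning
    Y′ = Y ⊕ pair u v
    Y′u : Y′ u ≡ false
    Y′u rewrite Yu | ==-refl u = refl
    Y′v : Y′ v ≡ false
    Y′v rewrite Yv | ==-no (λ v≡u → u≢v (sym v≡u)) | ==-refl v = refl

pair-xor : ∀ {n} {u v : Fin n} → u ≢ v → ∀ z → pair u v z ≡ (z == u) xor (z == v)
pair-xor {u = u} {v} u≢v z = by-cases (z ≟ u)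
  where
  by-cases : Dec (z ≡ u) → pair u v z ≡ (z == u) xor (z == v)
  by-cases (yes refl) rewrite ==-refl z | ==-no u≢v = refl
  by-cases (no z≢u) rewrite ==-no z≢u = refl

det-pivot-sequence : ∀ {n} (G : Adj n) → IsSimple G → (φ : PivotSeq n) → Applicable G φ → ∀ X →
  detInduced (applySeq G φ) X ≡ detInduced G (sup φ ⊕ X)
det-pivot-sequence G simple [] _ X = refl
det-pivot-sequence G simple ((u , v) ∷ ψ) (uv , applicable) X = begin
  detInduced (applySeq (pivot G u v) ψ) X       ≡⟨ det-pivot-sequence (pivot G u v) (pivot-simple G u v simple) ψ applicable X ⟩
  detInduced (pivot G u v) (sup ψ ⊕ X)          ≡⟨ det-pivot G simple uv (sup ψ ⊕ X) ⟩
  detInduced G ((sup ψ ⊕ X) ⊕ pair u v)         ≡⟨ detInduced-cong (λ _ _ → refl) support ⟩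
  detInduced G (sup ((u , v) ∷ ψ) ⊕ X)          ∎
  where
  open ≡-Reasoning
  support : ∀ z → (sup ψ z xor X z) xor pair u v z ≡ (((z == u) xor (z == v)) xor sup ψ z) xor X z
  support z rewrite pair-xor (PivotOnEdge.u≢v G simple uv) z =
    trans (xor-comm (sup ψ z xor X z) _) (sym (xor-assoc ((z == u) xor (z == v)) (sup ψ z) (X z)))

det-edge : ∀ {n} (H : Adj n) → IsSimple H → ∀ {x y} → x ≢ y → detInduced H (pair x y) ≡ H x y
det-edge H (symmetric , loopless) {x} {y} x≢y = begin
  detInduced H (pair x y)              ≡⟨ det-principal-perm H elems-pair (elems-unique (pair x y)) ⟩
  detRC H (x ∷ y ∷ []) (x ∷ y ∷ [])    ≡⟨ two-by-two ⟩
  H x y                                ∎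
  where
  open ≡-Reasoning
  y≢x : y ≢ x
  y≢x y≡x = x≢y (sym y≡x)
  elems-pair : elems (pair x y) ↭ x ∷ y ∷ []
  elems-pair = ↭.trans
    (elems-insert (pair x y) (_== y) x (cong (_∨ (x == y)) (==-refl x)) (==-no x≢y) (λ z z≢x → cong (_∨ (z == y)) (==-no z≢x)))
    (↭.prep x (↭.trans (elems-insert (_== y) (λ _ → false) y (==-refl y) refl (λ z → ==-no))
      (↭.prep y (↭.↭-reflexive elems-empty))))
  idem : ∀ a → (a ∧ ((a ∧ true) xor false)) xor false ≡ a
  idem true = refl
  idem false = refl
  two-by-two : detRC H (x ∷ y ∷ []) (x ∷ y ∷ []) ≡ H x y
  two-by-two rewrite ==-refl x | ==-no y≢x | ==-refl y | loopless x | symmetric y x = idem (H x y)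

theorem2 : {n : ℕ} (G : Adj n) → IsSimple G → (φ : PivotSeq n) → Applicable G φ →
    (x y : Fin n) → ¬ (x ≡ y) →
      (detInduced (applySeq G φ) (pair x y) ≡ detInduced G (sup φ ⊕ pair x y))
      × ((applySeq G φ x y ≡ true) ⇔ (detInduced G (sup φ ⊕ pair x y) ≡ true))
theorem2 G simple φ applicable x y x≢y = minor , mk⇔ (trans (sym adjacency)) (trans adjacency)
  where
  minor : detInduced (applySeq G φ) (pair x y) ≡ detInduced G (sup φ ⊕ pair x y)
  minor = det-pivot-sequence G simple φ applicable (pair x y)
  adjacency : applySeq G φ x y ≡ detInduced G (sup φ ⊕ pair x y)
  adjacency = trans (sym (det-edge (applySeq G φ) (applySeq-simple G φ simple) x≢y)) minor
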